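{- Let $W\subseteq V(G)$ with $|W|\ge q$, and let $Z$ be a cover of $W$ with $k$ elements. Then there is an ordering $z_1,\ldots,z_k$ of the vertices of $Z$ and an integer $m\le k$ such that $(z_1,\ldots,z_m)$ is a pseudo-cover of $W$.
   Context: Graphs are finite, simple, undirected. $N(v)$ is the open and $N[v]=N(v)\cup\{v\}$ the closed neighborhood; $N[Z]=\bigcup_{z\in Z}N[z]$; $Z$ covers (dominates) $W$ if $W\subseteq N[Z]$. $\nabla_1(G)$ is the maximum of $|E(H)|/|V(H)|$ over all $1$-shallow minors $H$ of $G$ (graphs obtained from vertex-disjoint connected subgraphs of $G$ of radius at most $1$ as branch sets, adjacent when some edge of $G$ joins the branch sets). Standing assumptions: $G$ is a fixed graph such that for every $v\in V(G)$, $N(v)$ can be dominated by at most $2\nabla_1(G)$ vertices different from $v$. Set $\nabla_1=\nabla_1(G)$, $k=2\nabla_1$, $\alpha=1/k$, $\ell=4k^3+1$, $q=4k^4$. A vertex $z$ is $\alpha$-strong for $W$ if $|N[z]\cap W|\ge\alpha|W|$. A pseudo-cover of $W\subseteq V(G)$ is a sequence $(v_1,\ldots,v_m)$ of vertices such that $|W\setminus\bigcup_{i\le m}N[v_i]|\le q$, $m\le k$, and for every $i\le m$: $v_i$ is $\alpha$-strong for $W\setminus\bigcup_{j<i}N[v_j]$ and $|N[v_i]\cap(W\setminus\bigcup_{j<i}N[v_j])|\ge\ell$. -}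

module Defs where

open import Data.Bool using (Bool; true; false; _∧_; _∨_)
open import Data.Nat using (ℕ; zero; suc; _<ᵇ_)
import Data.Nat as ℕ
open import Data.Fin using (Fin; toℕ; _≟_)
open import Data.Fin.Subset using (Subset; _∈_; _∉_; _⊆_; _∩_; _∪_; _─_; ∣_∣; ⊥)
open import Data.Vec using (tabulate)
open import Data.List using (List; []; _∷_; length; foldr; map)
open import Data.List.Relation.Unary.All using (All)
open import Data.Maybe using (Maybe; just; nothing)
open import Data.Product using (Σ; _×_; ∃)
open import Data.Unit using (⊤)
open import Data.Sum using (_⊎_)
open import Data.Integer using (+_)
open import Data.Rational using (ℚ; _/_; _≤_; _*_; _+_; 0ℚ; 1ℚ)
open import Relation.Nullary.Decidable using (⌊_⌋)
open import Relation.Binary.PropositionalEquality using (_≡_; _≢_)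

#_ : ℕ → ℚ
# n = + n / 1

record Graph : Set where
  field
    n       : ℕ
    adj     : Fin n → Fin n → Bool
    sym     : ∀ u v → adj u v ≡ adj v u
    irrefl  : ∀ v → adj v v ≡ false

countF : ∀ {m} → (Fin m → Bool) → ℕ
countF f = ∣ tabulate f ∣

anyF : ∀ {m} → (Fin m → Bool) → Bool
anyF {zero}  f = false
anyF {suc m} f = f Fin.zero ∨ anyF (λ i → f (Fin.suc i))

sumF : ∀ {m} → (Fin m → ℕ) → ℕ
sumF {zero}  f = 0
sumF {suc m} f = f Fin.zero ℕ.+ sumF (λ i → f (Fin.suc i))

-- |E(H)| / |V(H)| (with 0 for the empty graph, which never occurs below)
ratio : ℕ → ℕ → ℚ
ratio e zero    = 0ℚ
ratio e (suc h) = + e / suc h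

module _ (G : Graph) where
  open Graph G

  Nc : Fin n → Subset n
  Nc v = tabulate (λ u → ⌊ u ≟ v ⌋ ∨ adj v u)

  No : Fin n → Subset n
  No v = tabulate (λ u → adj v u)

  NcL : List (Fin n) → Subset n
  NcL zs = foldr _∪_ ⊥ (map Nc zs)

  -- A 1-shallow minor: h ≥ 1 vertex-disjoint branch sets (branch v = just i means
  -- v lies in the i-th branch set, nothing = v unused), each containing a centre
  -- adjacent to every other vertex of its branch set (radius ≤ 1, hence connected).
  record ShallowMinor1 : Set where
    field
      h        : ℕ
      h≥1      : 1 ℕ.≤ h
      center   : Fin h → Fin n
      branch   : Fin n → Maybe (Fin h)
      center∈  : ∀ i → branch (center i) ≡ just i
      radius≤1 : ∀ v i → branch v ≡ just i → v ≡ center i ⊎ adj v (center i) ≡ true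
    inB : Fin n → Fin h → Bool
    inB v i with branch v
    ... | nothing = false
    ... | just j  = ⌊ j ≟ i ⌋
    hadj : Fin h → Fin h → Bool
    hadj i j = anyF (λ u → anyF (λ v → inB u i ∧ inB v j ∧ adj u v))
    edges : ℕ
    edges = sumF (λ i → countF (λ j → (toℕ i <ᵇ toℕ j) ∧ hadj i j))
    density : ℚ
    density = ratio edges h

  IsNabla1 : ℚ → Set
  IsNabla1 ∇ = (∀ (M : ShallowMinor1) → ShallowMinor1.density M ≤ ∇)
             × Σ ShallowMinor1 (λ M → ShallowMinor1.density M ≡ ∇)

  StandingAssumption : ℚ → Set
  StandingAssumption k = ∀ v → Σ (List (Fin n)) (λ D →
      (# length D ≤ k) × All (λ d → d ≢ v) D × No v ⊆ NcL D)

  -- parameters (given k = 2∇₁)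
  ℓ-of : ℚ → ℚ
  ℓ-of k = (# 4) * (k * k * k) + 1ℚ

  q-of : ℚ → ℚ
  q-of k = (# 4) * (k * k * k * k)

  -- z is α-strong for W, α = 1/k, written with the denominator cleared:
  -- α|W| ≤ |N[z] ∩ W|  ⇔  |W| ≤ k · |N[z] ∩ W|   (k > 0)
  AlphaStrong : ℚ → Fin n → Subset n → Set
  AlphaStrong k z W = # ∣ W ∣ ≤ k * (# ∣ Nc z ∩ W ∣)

  -- the per-step conditions of a pseudo-cover; W is the still-uncovered part
  Steps : ℚ → Subset n → List (Fin n) → Set
  Steps k W []       = ⊤
  Steps k W (v ∷ vs) = AlphaStrong k v W × (ℓ-of k ≤ # ∣ Nc v ∩ W ∣) × Steps k (W ─ Nc v) vs

  PseudoCover : ℚ → Subset n → List (Fin n) → Set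
  PseudoCover k W vs = (# ∣ W ─ NcL vs ∣ ≤ q-of k) × (# length vs ≤ k) × Steps k W vs

-- Greedy choice: while more than q vertices of W are uncovered, pick the vertex of Z that
-- covers most of the uncovered part R. Since the k vertices of Z cover R, that vertex covers
-- at least |R|/k of R, so it is α-strong; and as |R| > q = k · 4k³ it covers more than 4k³,
-- i.e. at least ℓ, vertices. The remaining vertices of Z cover what is left, so the process
-- continues with one vertex fewer, and stops after at most k steps.
module Submission where

open import Defs
open import Data.Nat using (ℕ)
open import Data.Fin using (Fin)
open import Data.Fin.Subset using (Subset; _⊆_; ∣_∣)
open import Data.List using (List; length; take)
open import Data.List.Relation.Unary.Unique.Propositional using (Unique)
open import Data.List.Relation.Binary.Permutation.Propositional using (_↭_)
open import Data.Product using (Σ; _×_)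
open import Data.Rational using (ℚ; _≤_; _*_)
open import Relation.Binary.PropositionalEquality using (_≡_)

open import Data.Nat as ℕ using (zero; suc; z≤n; s≤s; _<_)
import Data.Nat.Properties as ℕ
open import Data.Nat.ListAction using (sum)
open import Data.Nat.Tactic.RingSolver using (solve-∀)
open import Data.Nat.Coprimality using (1-coprimeTo) renaming (sym to coprime-sym)
open import Data.Integer using (+_)
import Data.Integer.Properties as ℤ
import Data.Integer as ℤ
open import Data.Rational using (mkℚ; *≤*; _/_; _+_)
import Data.Rational.Properties as ℚ
open import Data.Fin.Subset using (_∪_; _∩_; _─_; ⊥; inside; outside; _∈_; _∉_)
open import Data.Fin.Subset.Properties
  using (∪-isCommutativeMonoid; ∣p∣≤∣x∷p∣; ∣⊥∣≡0; p─⊥≡p; p─q─r≡p─q∪r; p⊆q⇒∣p∣≤∣q∣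
        ; x∈p∪q⁻; x∈p∩q⁺; p─q⊆p; ∩-distribʳ-∪; ∩-zeroˡ)
open import Data.List using ([]; _∷_; _++_; map; foldr)
open import Data.List.Membership.Propositional using () renaming (_∈_ to _∈ₗ_)
open import Data.List.Membership.Propositional.Properties using (∈-∃++)
open import Data.List.Relation.Unary.All as All using (All; []; _∷_)
open import Data.List.Relation.Unary.Any using (here; there)
open import Data.List.Relation.Binary.Permutation.Propositional using (prep; ↭-refl; ↭-sym; ↭-trans; ↭⇒↭ₛ)
open import Data.List.Relation.Binary.Permutation.Propositional.Properties using (shift; ↭-length; map⁺)
open import Data.List.Relation.Binary.Permutation.Setoid.Properties using (foldr-commMonoid)
open import Data.List.Properties using (length-take)
open import Data.List.Extrema.Nat using (argmax; argmax-all; f[xs]≤f[argmax]; f[⊥]≤f[argmax])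
open import Data.Vec as Vec using (_∷_; [])
open import Data.Product using (_,_; proj₁; proj₂)
open import Data.Sum using (inj₁; inj₂)
open import Data.Empty using (⊥-elim)
open import Data.Unit using (tt)
open import Relation.Nullary using (yes; no)
open import Relation.Binary.PropositionalEquality
  using (refl; sym; trans; cong; subst; subst₂; setoid)

#-canonical : ∀ n → # n ≡ mkℚ (+ n) 0 (coprime-sym (1-coprimeTo n))
#-canonical n = ℚ.normalize-coprime (coprime-sym (1-coprimeTo n))

#-homo-* : ∀ m n → # (m ℕ.* n) ≡ # m * # n
#-homo-* m n rewrite #-canonical m | #-canonical n = cong (_/ 1) (ℤ.pos-* m n)

#-homo-+ : ∀ m n → # (m ℕ.+ n) ≡ # m + # n
#-homo-+ m n rewrite #-canonical m | #-canonical n | ℤ.*-identityʳ (+ m) | ℤ.*-identityʳ (+ n) =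
  cong (_/ 1) (ℤ.pos-+ m n)

#-mono-≤ : ∀ {m n} → m ℕ.≤ n → # m ≤ # n
#-mono-≤ {m} {n} m≤n rewrite #-canonical m | #-canonical n =
  *≤* (subst₂ ℤ._≤_ (sym (ℤ.*-identityʳ (+ m))) (sym (ℤ.*-identityʳ (+ n))) (ℤ.+≤+ m≤n))

x∈p─q⇒x∉q : ∀ {n} {x : Fin n} (p q : Subset n) → x ∈ p ─ q → x ∉ q
x∈p─q⇒x∉q (_ ∷ p) (_ ∷ q)      (Vec.there x∈p─q) (Vec.there x∈q) = x∈p─q⇒x∉q p q x∈p─q x∈q
x∈p─q⇒x∉q (_ ∷ p) (inside ∷ q) () Vec.here

p⊆q∪r⇒p─q⊆r : ∀ {n} {p q r : Subset n} → p ⊆ q ∪ r → p ─ q ⊆ r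
p⊆q∪r⇒p─q⊆r {p = p} {q} {r} p⊆q∪r x∈p─q with x∈p∪q⁻ q r (p⊆q∪r (p─q⊆p p q x∈p─q))
... | inj₁ x∈q = ⊥-elim (x∈p─q⇒x∉q p q x∈p─q x∈q)
... | inj₂ x∈r = x∈r

∣p∪q∣≤∣p∣+∣q∣ : ∀ {n} (p q : Subset n) → ∣ p ∪ q ∣ ℕ.≤ ∣ p ∣ ℕ.+ ∣ q ∣
∣p∪q∣≤∣p∣+∣q∣ []            []            = z≤n
∣p∪q∣≤∣p∣+∣q∣ (inside ∷ p)  (x ∷ q)       =
  s≤s (ℕ.≤-trans (∣p∪q∣≤∣p∣+∣q∣ p q) (ℕ.+-monoʳ-≤ ∣ p ∣ (∣p∣≤∣x∷p∣ x q)))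
∣p∪q∣≤∣p∣+∣q∣ (outside ∷ p) (inside ∷ q)  =
  subst (suc ∣ p ∪ q ∣ ℕ.≤_) (sym (ℕ.+-suc ∣ p ∣ ∣ q ∣)) (s≤s (∣p∪q∣≤∣p∣+∣q∣ p q))
∣p∪q∣≤∣p∣+∣q∣ (outside ∷ p) (outside ∷ q) = ∣p∪q∣≤∣p∣+∣q∣ p q

∣⋃∩r∣≤sum : ∀ {A : Set} {n} (N : A → Subset n) (r : Subset n) (as : List A) →
            ∣ foldr _∪_ ⊥ (map N as) ∩ r ∣ ℕ.≤ sum (map (λ a → ∣ N a ∩ r ∣) as)
∣⋃∩r∣≤sum {n = n} N r [] = ℕ.≤-reflexive (trans (cong ∣_∣ (∩-zeroˡ r)) (∣⊥∣≡0 n))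
∣⋃∩r∣≤sum N r (a ∷ as) = begin
  ∣ (N a ∪ U) ∩ r ∣           ≡⟨ cong ∣_∣ (∩-distribʳ-∪ r (N a) U) ⟩
  ∣ (N a ∩ r) ∪ (U ∩ r) ∣     ≤⟨ ∣p∪q∣≤∣p∣+∣q∣ (N a ∩ r) (U ∩ r) ⟩
  ∣ N a ∩ r ∣ ℕ.+ ∣ U ∩ r ∣   ≤⟨ ℕ.+-monoʳ-≤ ∣ N a ∩ r ∣ (∣⋃∩r∣≤sum N r as) ⟩
  sum (map (λ a → ∣ N a ∩ r ∣) (a ∷ as)) ∎
  where
  open ℕ.≤-Reasoning
  U = foldr _∪_ ⊥ (map N as)

sum-map≤length* : ∀ {A : Set} (f : A → ℕ) {c} {xs : List A} →
                  All (λ x → f x ℕ.≤ c) xs → sum (map f xs) ℕ.≤ length xs ℕ.* c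
sum-map≤length* f []              = z≤n
sum-map≤length* f (fx≤c ∷ fxs≤c) = ℕ.+-mono-≤ fx≤c (sum-map≤length* f fxs≤c)

sum-map≤length*argmax : ∀ {A : Set} (f : A → ℕ) x xs →
                        sum (map f (x ∷ xs)) ℕ.≤ length (x ∷ xs) ℕ.* f (argmax f x xs)
sum-map≤length*argmax f x xs =
  sum-map≤length* f (f[⊥]≤f[argmax] {f = f} x xs ∷ f[xs]≤f[argmax] {f = f} x xs)

argmax∈ : ∀ {A : Set} (f : A → ℕ) x xs → argmax f x xs ∈ₗ x ∷ xs
argmax∈ f x xs = argmax-all f (here refl) (All.tabulate there)

∈⇒↭∷ : ∀ {A : Set} {x : A} {xs} → x ∈ₗ xs → Σ (List A) λ ys → xs ↭ x ∷ ys
∈⇒↭∷ {x = x} x∈xs with ys , zs , refl ← ∈-∃++ x∈xs = ys ++ zs , shift x ys zs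

ℓₙ qₙ : ℕ → ℕ
ℓₙ K = suc (4 ℕ.* (K ℕ.* K ℕ.* K))
qₙ K = 4 ℕ.* (K ℕ.* K ℕ.* K ℕ.* K)

qₙ≡K*4K³ : ∀ K → 4 ℕ.* (K ℕ.* K ℕ.* K ℕ.* K) ≡ K ℕ.* (4 ℕ.* (K ℕ.* K ℕ.* K))
qₙ≡K*4K³ = solve-∀

qₙ<K*c⇒ℓₙ≤c : ∀ K c → qₙ K < K ℕ.* c → ℓₙ K ℕ.≤ c
qₙ<K*c⇒ℓₙ≤c K c q<Kc = ℕ.*-cancelˡ-< K _ c (subst (_< K ℕ.* c) (qₙ≡K*4K³ K) q<Kc)

module _ (G : Graph) where
  open Graph G using (n)

  coverage : Subset n → Fin n → ℕ
  coverage R z = ∣ Nc G z ∩ R ∣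

  NcL-↭ : ∀ {Y Z} → Y ↭ Z → NcL G Y ≡ NcL G Z
  NcL-↭ Y↭Z = foldr-commMonoid (setoid (Subset n)) (∪-isCommutativeMonoid n) (↭⇒↭ₛ (map⁺ (Nc G) Y↭Z))

  ∣R∣≤sum-coverage : ∀ {R Z} → R ⊆ NcL G Z → ∣ R ∣ ℕ.≤ sum (map (coverage R) Z)
  ∣R∣≤sum-coverage {R} {Z} R⊆N[Z] =
    ℕ.≤-trans (p⊆q⇒∣p∣≤∣q∣ (λ x∈R → x∈p∩q⁺ (R⊆N[Z] x∈R , x∈R))) (∣⋃∩r∣≤sum (Nc G) R Z)

  ∣R∣≤K*coverage-argmax : ∀ {K R z₀ Z} → R ⊆ NcL G (z₀ ∷ Z) → length (z₀ ∷ Z) ℕ.≤ K →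
                          ∣ R ∣ ℕ.≤ K ℕ.* coverage R (argmax (coverage R) z₀ Z)
  ∣R∣≤K*coverage-argmax {K} {R} {z₀} {Z} R⊆N[Z] |Z|≤K = begin
    ∣ R ∣                                        ≤⟨ ∣R∣≤sum-coverage {Z = z₀ ∷ Z} R⊆N[Z] ⟩
    sum (map (coverage R) (z₀ ∷ Z))              ≤⟨ sum-map≤length*argmax (coverage R) z₀ Z ⟩
    length (z₀ ∷ Z) ℕ.* coverage R z             ≤⟨ ℕ.*-monoˡ-≤ (coverage R z) |Z|≤K ⟩
    K ℕ.* coverage R z                           ∎
    where
    open ℕ.≤-Reasoning
    z = argmax (coverage R) z₀ Z

  q-of-# : ∀ K → q-of G (# K) ≡ # qₙ K
  q-of-# K rewrite sym (#-homo-* K K) | sym (#-homo-* (K ℕ.* K) K) | sym (#-homo-* (K ℕ.* K ℕ.* K) K) =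
    sym (#-homo-* 4 (K ℕ.* K ℕ.* K ℕ.* K))

  ℓ-of-# : ∀ K → ℓ-of G (# K) ≡ # ℓₙ K
  ℓ-of-# K rewrite sym (#-homo-* K K) | sym (#-homo-* (K ℕ.* K) K) | sym (#-homo-* 4 (K ℕ.* K ℕ.* K)) =
    trans (sym (#-homo-+ 4K³ 1)) (cong #_ (ℕ.+-comm 4K³ 1))
    where 4K³ = 4 ℕ.* (K ℕ.* K ℕ.* K)

  OrderedPseudoCover : ℚ → Subset n → List (Fin n) → Set
  OrderedPseudoCover k W Z = Σ (List (Fin n)) λ zs → zs ↭ Z × Σ ℕ λ m → PseudoCover G k W (take m zs)

  pseudoCover-[] : ∀ {k W} → # ∣ W ∣ ≤ q-of G k → # 0 ≤ k → PseudoCover G k W []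
  pseudoCover-[] {k} {W} |W|≤q 0≤k = subst (λ V → # ∣ V ∣ ≤ q-of G k) (sym (p─⊥≡p W)) |W|≤q , 0≤k , tt

  pseudoCover-∷ : ∀ {k W z vs} → AlphaStrong G k z W → ℓ-of G k ≤ # coverage W z →
                  # suc (length vs) ≤ k → PseudoCover G k (W ─ Nc G z) vs → PseudoCover G k W (z ∷ vs)
  pseudoCover-∷ {k} {W} {z} {vs} strong ℓ≤ |z∷vs|≤k (rest≤q , _ , steps) =
    subst (λ V → # ∣ V ∣ ≤ q-of G k) (p─q─r≡p─q∪r W (Nc G z) (NcL G vs)) rest≤q ,
    |z∷vs|≤k , strong , ℓ≤ , steps

  orderedPseudoCover-∷ : ∀ {k W z rest Z} → Z ↭ z ∷ rest →
                         AlphaStrong G k z W → ℓ-of G k ≤ # coverage W z → # length Z ≤ k →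
                         OrderedPseudoCover k (W ─ Nc G z) rest → OrderedPseudoCover k W Z
  orderedPseudoCover-∷ {k} {W} {z} {rest} {Z} Z↭ strong ℓ≤ |Z|≤k (zs , zs↭rest , m , cover) =
    z ∷ zs , ↭-trans (prep z zs↭rest) (↭-sym Z↭) , suc m , pseudoCover-∷ strong ℓ≤ |z∷take|≤k cover
    where
    |take|≤|rest| : length (take m zs) ℕ.≤ length rest
    |take|≤|rest| = ℕ.≤-trans (ℕ.≤-reflexive (length-take m zs))
                      (ℕ.≤-trans (ℕ.m⊓n≤n m (length zs)) (ℕ.≤-reflexive (↭-length zs↭rest)))
    |z∷take|≤k : # suc (length (take m zs)) ≤ k
    |z∷take|≤k = ℚ.≤-trans (#-mono-≤ (s≤s |take|≤|rest|))
                   (subst (λ l → # l ≤ k) (↭-length Z↭) |Z|≤k)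

  cover⇒orderedPseudoCover : ∀ K d R Z → length Z ≡ d → length Z ℕ.≤ K → R ⊆ NcL G Z →
                             OrderedPseudoCover (# K) R Z
  cover⇒orderedPseudoCover K d R Z _ _ _ with ∣ R ∣ ℕ.≤? qₙ K
  ... | yes |R|≤q =
    Z , ↭-refl , 0 ,
    pseudoCover-[] {W = R} (subst (# ∣ R ∣ ≤_) (sym (q-of-# K)) (#-mono-≤ |R|≤q)) (#-mono-≤ {n = K} z≤n)
  cover⇒orderedPseudoCover K d R [] _ _ R⊆∅ | no |R|≰q =
    ⊥-elim (|R|≰q (ℕ.≤-trans (∣R∣≤sum-coverage {Z = []} R⊆∅) z≤n))
  cover⇒orderedPseudoCover K zero R (_ ∷ _) () _ _ | no _
  cover⇒orderedPseudoCover K (suc d) R (z₀ ∷ Z) |Z|≡d |Z|≤K R⊆N[Z] | no |R|≰q =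
    orderedPseudoCover-∷ Z↭z∷rest strong ℓ≤coverage (#-mono-≤ |Z|≤K)
      (cover⇒orderedPseudoCover K d (R ─ Nc G z) rest |rest|≡d |rest|≤K (p⊆q∪r⇒p─q⊆r R⊆N[z∷rest]))
    where
    z = argmax (coverage R) z₀ Z
    rest = proj₁ (∈⇒↭∷ (argmax∈ (coverage R) z₀ Z))
    Z↭z∷rest = proj₂ (∈⇒↭∷ (argmax∈ (coverage R) z₀ Z))
    |R|≤K*c : ∣ R ∣ ℕ.≤ K ℕ.* coverage R z
    |R|≤K*c = ∣R∣≤K*coverage-argmax {Z = Z} R⊆N[Z] |Z|≤K
    strong : AlphaStrong G (# K) z R
    strong = subst (# ∣ R ∣ ≤_) (#-homo-* K (coverage R z)) (#-mono-≤ |R|≤K*c)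
    ℓ≤coverage : ℓ-of G (# K) ≤ # coverage R z
    ℓ≤coverage = subst (_≤ # coverage R z) (sym (ℓ-of-# K))
                   (#-mono-≤ (qₙ<K*c⇒ℓₙ≤c K (coverage R z) (ℕ.<-≤-trans (ℕ.≰⇒> |R|≰q) |R|≤K*c)))
    |rest|≡d : length rest ≡ d
    |rest|≡d = ℕ.suc-injective (trans (sym (↭-length Z↭z∷rest)) |Z|≡d)
    |rest|≤K : length rest ℕ.≤ K
    |rest|≤K = ℕ.≤-trans (ℕ.n≤1+n _) (subst (ℕ._≤ K) (↭-length Z↭z∷rest) |Z|≤K)
    R⊆N[z∷rest] : R ⊆ Nc G z ∪ NcL G rest
    R⊆N[z∷rest] = subst (R ⊆_) (NcL-↭ Z↭z∷rest) R⊆N[Z]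

lemma3 : (G : Graph) (∇ : ℚ) → IsNabla1 G ∇ →
           StandingAssumption G ((# 2) * ∇) →
           (W : Subset (Graph.n G)) → q-of G ((# 2) * ∇) ≤ # ∣ W ∣ →
           (Z : List (Fin (Graph.n G))) → Unique Z → # length Z ≡ (# 2) * ∇ →
           W ⊆ NcL G Z →
           Σ (List (Fin (Graph.n G))) (λ zs → (zs ↭ Z) × Σ ℕ (λ m →
             PseudoCover G ((# 2) * ∇) W (take m zs)))
lemma3 G ∇ _ _ W _ Z _ |Z|≡k W⊆N[Z] =
  subst (λ k → OrderedPseudoCover G k W Z) |Z|≡k
    (cover⇒orderedPseudoCover G (length Z) (length Z) W Z refl ℕ.≤-refl W⊆N[Z])
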